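{- Let $m$ and $s$ be even integers with $m\geq 2$ and $s\geq 6$ such that there exists an odd prime $p$ dividing $s$. Let $t$ be a divisor of $\frac{2ms}{p}$ such that $t\equiv 0\pmod 8$, and set $\ell=\frac{2ms}{t}+1$. Then there exists a sequence $\mathcal{B}$ of $\frac{m}{2}$ blocks of size $2\times s$ such that $\mathcal{B}$ satisfies Condition (C) and $\operatorname{supp}(\mathcal{B})=[1,ms+t/2]\setminus\{j\ell: j\in[1,t/2]\}$.
   Context: For integers $a\leq b$, $[a,b]=\{a,a+1,\ldots,b\}$. A block is a (fully filled) array with integer entries; it is shiftable if every row and every column contains an equal number of positive and negative entries. For a sequence $\mathcal{B}$ of blocks, $\operatorname{supp}(\mathcal{B})$ is the set of absolute values of all entries of all blocks in $\mathcal{B}$. A sequence $\mathcal{B}$ of blocks satisfies Condition (C) if there exist integers $\sigma_1,\ldots,\sigma_b$ (the same for all blocks of the sequence) such that every element $B$ of $\mathcal{B}$ is a shiftable block of size $2\times 2b$ whose two rows each sum to $0$ and whose columns satisfy: the $(2i-1)$-th column sums to $\sigma_i$ and the $2i$-th column sums to $-\sigma_i$, for all $i\in[1,b]$. -}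

module Defs where

open import Data.Nat using (ℕ; zero; suc; _*_; _+_; _≤_)
open import Data.Integer using (ℤ; _<_; -_; ∣_∣; 0ℤ) renaming (_+_ to _+ℤ_)
open import Data.Integer.Properties using (_<?_)
open import Data.Fin using (Fin; toℕ)
open import Data.Product using (Σ; ∃; _×_)
open import Relation.Nullary using (does)
open import Relation.Binary.PropositionalEquality using (_≡_)
open import Data.Bool using (if_then_else_)

sumℤ : {n : ℕ} → (Fin n → ℤ) → ℤ
sumℤ {zero}  v = 0ℤ
sumℤ {suc n} v = v Data.Fin.zero +ℤ sumℤ (λ i → v (Data.Fin.suc i))

#pos : {n : ℕ} → (Fin n → ℤ) → ℕ
#pos {zero}  v = zero
#pos {suc n} v = (if does (0ℤ <? v Data.Fin.zero) then 1 else 0) + #pos (λ i → v (Data.Fin.suc i))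

#neg : {n : ℕ} → (Fin n → ℤ) → ℕ
#neg {zero}  v = zero
#neg {suc n} v = (if does (v Data.Fin.zero <? 0ℤ) then 1 else 0) + #neg (λ i → v (Data.Fin.suc i))

Block : ℕ → ℕ → Set
Block r c = Fin r → Fin c → ℤ

row : {r c : ℕ} → Block r c → Fin r → (Fin c → ℤ)
row B i = λ j → B i j

col : {r c : ℕ} → Block r c → Fin c → (Fin r → ℤ)
col B j = λ i → B i j

Shiftable : {r c : ℕ} → Block r c → Set
Shiftable {r} {c} B =
  ((i : Fin r) → #pos (row B i) ≡ #neg (row B i)) ×
  ((j : Fin c) → #pos (col B j) ≡ #neg (col B j))

-- Column with 0-based index 2i  (the paper's (2i+1)-th, i.e. (2(i+1)-1)-th) sums to σ i,
-- column with 0-based index 2i+1 (the paper's 2(i+1)-th) sums to - σ i.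
ConditionC : {k n : ℕ} → (Fin k → Block 2 n) → Set
ConditionC {k} {n} ℬ =
  Σ (ℕ → ℤ) λ σ → (q : Fin k) →
    Shiftable (ℬ q) ×
    ((i : Fin 2) → sumℤ (row (ℬ q) i) ≡ 0ℤ) ×
    ((i : ℕ) (j : Fin n) → toℕ j ≡ 2 * i → sumℤ (col (ℬ q) j) ≡ σ i) ×
    ((i : ℕ) (j : Fin n) → toℕ j ≡ 2 * i + 1 → sumℤ (col (ℬ q) j) ≡ - σ i)

InSupp : {k r c : ℕ} → (Fin k → Block r c) → ℕ → Set
InSupp {k} {r} {c} ℬ x = ∃ λ (q : Fin k) → ∃ λ (i : Fin r) → ∃ λ (j : Fin c) → ∣ ℬ q i j ∣ ≡ x

-- Put M = m/2, w = s/2, g = t/8 and K = 2ms/t, so that Mw = gK and ℓ = K + 1.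
-- The required support [1, 4gℓ] minus the multiples of ℓ consists of the numbers
-- 1 + ρ + Qℓ with ρ < K and Q < 4g; writing ρ = f mod K and Q = o + 4⌊f/K⌋ indexes
-- them by pairs (f, o) with f < gK = Mw and o < 4.  The f-th column pair (pair i of
-- block q, f = i + qw) is a 2 × 2 tile holding the four numbers with this f, signed
-- in a checkerboard pattern, which makes every row and column shiftable.  A tile's
-- row sums are ±ℓ or ±2ℓ and its column sums ±σ, both fixed by the tile type; taking
-- types with top-row sums ℓ, −ℓ, ℓ, −ℓ, … (w even) or 2ℓ, −ℓ, −ℓ, ℓ, −ℓ, … (w odd,
-- here w ≥ 3 is used) makes every row sum vanish.

module Submission where

open import Defs
open import Data.Nat
  using (ℕ; zero; suc; _+_; _*_; _≤_; _<_; _/_; _%_; ⌊_/2⌋; parity; NonZero; >-nonZero; z≤n; s≤s)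
import Data.Nat.Properties as ℕ
open import Data.Nat.DivMod
open import Data.Nat.Primality using (Prime)
open import Data.Nat.Divisibility using (_∣_; n∣m*n; ∣n⇒∣m*n; m∣n/o⇒m*o∣n; m*n∣⇒m∣; ∣⇒≤)
open import Data.Nat.Tactic.RingSolver using (solve-∀)
open import Data.Integer.Tactic.RingSolver renaming (solve-∀ to ℤ-solve-∀)
open import Data.Parity.Base using (Parity; 0ℙ; 1ℙ)
open import Data.Integer using (ℤ; +_; 0ℤ; -_; _⊖_; _◃_; ∣_∣)
  renaming (_+_ to _+ℤ_; _-_ to _-ℤ_; _*_ to _*ℤ_)
import Data.Integer.Properties as ℤ
open import Data.Sign as Sign using (Sign)
open import Data.Fin using (Fin; zero; suc; toℕ; fromℕ<)
open import Data.Fin.Properties using (toℕ<n; toℕ-fromℕ<)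
open import Function.Bundles using (_⇔_; mk⇔)
open import Data.Product using (Σ; ∃; ∃₂; _×_; _,_)
open import Relation.Nullary using (¬_; does)
open import Data.Bool using (if_then_else_)
open import Data.Vec.Functional using ([]; _∷_)
open import Relation.Binary.PropositionalEquality

double : ℕ → ℕ
double zero    = zero
double (suc n) = suc (suc (double n))

column : ℕ → Parity → ℕ
column i 0ℙ = double i
column i 1ℙ = suc (double i)

⌊column/2⌋≡i : ∀ i c → ⌊ column i c /2⌋ ≡ i
⌊column/2⌋≡i zero    0ℙ = refl
⌊column/2⌋≡i zero    1ℙ = refl
⌊column/2⌋≡i (suc i) 0ℙ = cong suc (⌊column/2⌋≡i i 0ℙ)
⌊column/2⌋≡i (suc i) 1ℙ = cong suc (⌊column/2⌋≡i i 1ℙ)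

parity-column : ∀ i c → parity (column i c) ≡ c
parity-column zero    0ℙ = refl
parity-column zero    1ℙ = refl
parity-column (suc i) 0ℙ = parity-column i 0ℙ
parity-column (suc i) 1ℙ = parity-column i 1ℙ

column-⌊/2⌋-parity : ∀ j → column ⌊ j /2⌋ (parity j) ≡ j
column-⌊/2⌋-parity zero          = refl
column-⌊/2⌋-parity (suc zero)    = refl
column-⌊/2⌋-parity (suc (suc j)) with parity j | column-⌊/2⌋-parity j
... | 0ℙ | eq = cong (λ n → suc (suc n)) eq
... | 1ℙ | eq = cong (λ n → suc (suc n)) eq

column<double : ∀ {i w} c → i < w → column i c < double w
column<double {zero}  {suc w} 0ℙ _         = s≤s z≤n
column<double {zero}  {suc w} 1ℙ _         = s≤s (s≤s z≤n)
column<double {suc i} {suc w} 0ℙ (s≤s i<w) = s≤s (s≤s (column<double 0ℙ i<w))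
column<double {suc i} {suc w} 1ℙ (s≤s i<w) = s≤s (s≤s (column<double 1ℙ i<w))

⌊j/2⌋<w : ∀ {j w} → j < double w → ⌊ j /2⌋ < w
⌊j/2⌋<w {zero}        {suc w} _                 = s≤s z≤n
⌊j/2⌋<w {suc zero}    {suc w} _                 = s≤s z≤n
⌊j/2⌋<w {suc (suc j)} {suc w} (s≤s (s≤s j<2w)) = s≤s (⌊j/2⌋<w j<2w)

double≡2* : ∀ n → double n ≡ 2 * n
double≡2* zero    = refl
double≡2* (suc n) = cong suc (trans (cong suc (double≡2* n)) (sym (ℕ.+-suc n (n + 0))))

sumℤ-pairs : ∀ w (g h : ℕ → ℤ) → (∀ i → g (column i 0ℙ) +ℤ g (column i 1ℙ) ≡ h i) →
             sumℤ {double w} (λ j → g (toℕ j)) ≡ sumℤ {w} (λ i → h (toℕ i))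
sumℤ-pairs zero    g h pair = refl
sumℤ-pairs (suc w) g h pair = begin
  g 0 +ℤ (g 1 +ℤ sumℤ {double w} (λ j → g (2 + toℕ j)))  ≡⟨ ℤ.+-assoc (g 0) (g 1) _ ⟨
  (g 0 +ℤ g 1) +ℤ sumℤ {double w} (λ j → g (2 + toℕ j))  ≡⟨ cong₂ _+ℤ_ (pair 0) rest ⟩
  h 0 +ℤ sumℤ {w} (λ i → h (suc (toℕ i)))                  ∎
  where
  open ≡-Reasoning
  rest = sumℤ-pairs w (λ j → g (suc (suc j))) (λ i → h (suc i)) (λ i → pair (suc i))

sumℤ-*ʳ : ∀ {n} (f : Fin n → ℤ) c → sumℤ (λ i → f i *ℤ c) ≡ sumℤ f *ℤ c
sumℤ-*ʳ {zero}  f c = refl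
sumℤ-*ʳ {suc n} f c = begin
  f zero *ℤ c +ℤ sumℤ {n} (λ i → f (suc i) *ℤ c)
    ≡⟨ cong (f zero *ℤ c +ℤ_) (sumℤ-*ʳ (λ i → f (suc i)) c) ⟩
  f zero *ℤ c +ℤ sumℤ {n} (λ i → f (suc i)) *ℤ c  ≡⟨ ℤ.*-distribʳ-+ c (f zero) _ ⟨
  (f zero +ℤ sumℤ {n} (λ i → f (suc i))) *ℤ c     ∎
  where open ≡-Reasoning

[0<_] [_<0] : ℤ → ℕ
[0< z ] = if does (0ℤ ℤ.<? z) then 1 else 0
[ z <0] = if does (z ℤ.<? 0ℤ) then 1 else 0

#pos≡#neg-pairs : ∀ w (g : ℕ → ℤ) →
  (∀ i → #pos (g (column i 0ℙ) ∷ g (column i 1ℙ) ∷ []) ≡ #neg (g (column i 0ℙ) ∷ g (column i 1ℙ) ∷ [])) →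
  #pos {double w} (λ j → g (toℕ j)) ≡ #neg {double w} (λ j → g (toℕ j))
#pos≡#neg-pairs zero    g pair = refl
#pos≡#neg-pairs (suc w) g pair =
  combine [0< g 0 ] [0< g 1 ] [ g 0 <0] [ g 1 <0] (pair 0)
          (#pos≡#neg-pairs w (λ j → g (suc (suc j))) (λ i → pair (suc i)))
  where
  combine : ∀ a b c d {p n} → a + (b + 0) ≡ c + (d + 0) → p ≡ n → a + (b + p) ≡ c + (d + n)
  combine a b c d {p} {n} first rest = begin
    a + (b + p)  ≡⟨ ℕ.+-assoc a b p ⟨
    a + b + p    ≡⟨ cong₂ _+_ pairs rest ⟩
    c + d + n    ≡⟨ ℕ.+-assoc c d n ⟩
    c + (d + n)  ∎
    where
    open ≡-Reasoning
    pairs = subst₂ (λ x y → a + x ≡ c + y) (ℕ.+-identityʳ b) (ℕ.+-identityʳ d) first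

-- Named after the sum of the top row of the tile, in units of ℓ.
data TileType : Set where
  plus₁ minus₁ plus₂ : TileType

offset : TileType → Fin 2 → Parity → ℕ
offset plus₁  zero       0ℙ = 1
offset plus₁  zero       1ℙ = 0
offset plus₁  (suc zero) 0ℙ = 3
offset plus₁  (suc zero) 1ℙ = 2
offset minus₁ zero       0ℙ = 0
offset minus₁ zero       1ℙ = 1
offset minus₁ (suc zero) 0ℙ = 2
offset minus₁ (suc zero) 1ℙ = 3
offset plus₂  zero       0ℙ = 2
offset plus₂  zero       1ℙ = 0
offset plus₂  (suc zero) 0ℙ = 3
offset plus₂  (suc zero) 1ℙ = 1

offset<4 : ∀ t r c → offset t r c < 4
offset<4 plus₁  zero       0ℙ = ℕ.<ᵇ⇒< _ _ _
offset<4 plus₁  zero       1ℙ = ℕ.<ᵇ⇒< _ _ _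
offset<4 plus₁  (suc zero) 0ℙ = ℕ.<ᵇ⇒< _ _ _
offset<4 plus₁  (suc zero) 1ℙ = ℕ.<ᵇ⇒< _ _ _
offset<4 minus₁ zero       0ℙ = ℕ.<ᵇ⇒< _ _ _
offset<4 minus₁ zero       1ℙ = ℕ.<ᵇ⇒< _ _ _
offset<4 minus₁ (suc zero) 0ℙ = ℕ.<ᵇ⇒< _ _ _
offset<4 minus₁ (suc zero) 1ℙ = ℕ.<ᵇ⇒< _ _ _
offset<4 plus₂  zero       0ℙ = ℕ.<ᵇ⇒< _ _ _
offset<4 plus₂  zero       1ℙ = ℕ.<ᵇ⇒< _ _ _
offset<4 plus₂  (suc zero) 0ℙ = ℕ.<ᵇ⇒< _ _ _
offset<4 plus₂  (suc zero) 1ℙ = ℕ.<ᵇ⇒< _ _ _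

offset-surjective : ∀ t o → o < 4 → ∃₂ λ r c → offset t r c ≡ o
offset-surjective plus₁  0 _ = zero , 1ℙ , refl
offset-surjective plus₁  1 _ = zero , 0ℙ , refl
offset-surjective plus₁  2 _ = suc zero , 1ℙ , refl
offset-surjective plus₁  3 _ = suc zero , 0ℙ , refl
offset-surjective minus₁ 0 _ = zero , 0ℙ , refl
offset-surjective minus₁ 1 _ = zero , 1ℙ , refl
offset-surjective minus₁ 2 _ = suc zero , 0ℙ , refl
offset-surjective minus₁ 3 _ = suc zero , 1ℙ , refl
offset-surjective plus₂  0 _ = zero , 1ℙ , refl
offset-surjective plus₂  1 _ = suc zero , 1ℙ , refl
offset-surjective plus₂  2 _ = zero , 0ℙ , refl
offset-surjective plus₂  3 _ = suc zero , 0ℙ , refl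
offset-surjective t (suc (suc (suc (suc o)))) (s≤s (s≤s (s≤s (s≤s ()))))

tileSign : Fin 2 → Parity → Sign
tileSign zero       0ℙ = Sign.+
tileSign zero       1ℙ = Sign.-
tileSign (suc zero) 0ℙ = Sign.-
tileSign (suc zero) 1ℙ = Sign.+

rowWeight : TileType → Fin 2 → ℤ
rowWeight t zero       = offset t zero 0ℙ ⊖ offset t zero 1ℙ
rowWeight t (suc zero) = offset t (suc zero) 1ℙ ⊖ offset t (suc zero) 0ℙ

colWeight : TileType → Parity → ℤ
colWeight t 0ℙ = offset t zero 0ℙ ⊖ offset t (suc zero) 0ℙ
colWeight t 1ℙ = offset t (suc zero) 1ℙ ⊖ offset t zero 1ℙ

colWeight-1ℙ : ∀ t → colWeight t 1ℙ ≡ - colWeight t 0ℙ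
colWeight-1ℙ plus₁  = refl
colWeight-1ℙ minus₁ = refl
colWeight-1ℙ plus₂  = refl

[1+b+xℓ]⊖[1+b+yℓ] : ∀ b x y ℓ → suc (b + x * ℓ) ⊖ suc (b + y * ℓ) ≡ (x ⊖ y) *ℤ + ℓ
[1+b+xℓ]⊖[1+b+yℓ] b x y ℓ = begin
  suc (b + x * ℓ) ⊖ suc (b + y * ℓ)  ≡⟨ ℤ.[1+m]⊖[1+n]≡m⊖n (b + x * ℓ) (b + y * ℓ) ⟩
  (b + x * ℓ) ⊖ (b + y * ℓ)          ≡⟨ ℤ.+-cancelˡ-⊖ b (x * ℓ) (y * ℓ) ⟩
  (x * ℓ) ⊖ (y * ℓ)                  ≡⟨ ℤ.[+m]-[+n]≡m⊖n (x * ℓ) (y * ℓ) ⟨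
  + (x * ℓ) -ℤ + (y * ℓ)            ≡⟨ cong₂ _-ℤ_ (ℤ.pos-* x ℓ) (ℤ.pos-* y ℓ) ⟩
  + x *ℤ + ℓ -ℤ + y *ℤ + ℓ          ≡⟨ cong (λ a → + x *ℤ + ℓ +ℤ a) (ℤ.neg-distribˡ-* (+ y) (+ ℓ)) ⟩
  + x *ℤ + ℓ +ℤ (- + y) *ℤ + ℓ       ≡⟨ ℤ.*-distribʳ-+ (+ ℓ) (+ x) (- + y) ⟨
  (+ x -ℤ + y) *ℤ + ℓ               ≡⟨ cong (_*ℤ + ℓ) (ℤ.[+m]-[+n]≡m⊖n x y) ⟩
  (x ⊖ y) *ℤ + ℓ                     ∎
  where open ≡-Reasoning

module Tiles (ℓ : ℕ) where

  tileEntry : TileType → ℕ → Fin 2 → Parity → ℤ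
  tileEntry t b r c = tileSign r c ◃ suc (b + offset t r c * ℓ)

  ∣tileEntry∣ : ∀ t b r c → ∣ tileEntry t b r c ∣ ≡ suc (b + offset t r c * ℓ)
  ∣tileEntry∣ t b r c = ℤ.abs-◃ (tileSign r c) _

  tile-rowSum : ∀ t b r → tileEntry t b r 0ℙ +ℤ tileEntry t b r 1ℙ ≡ rowWeight t r *ℤ + ℓ
  tile-rowSum t b zero       = [1+b+xℓ]⊖[1+b+yℓ] b (offset t zero 0ℙ) (offset t zero 1ℙ) ℓ
  tile-rowSum t b (suc zero) = [1+b+xℓ]⊖[1+b+yℓ] b (offset t (suc zero) 1ℙ) (offset t (suc zero) 0ℙ) ℓ

  tile-colSum : ∀ t b c → sumℤ (λ r → tileEntry t b r c) ≡ colWeight t c *ℤ + ℓ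
  tile-colSum t b 0ℙ =
    trans (cong (tileEntry t b zero 0ℙ +ℤ_) (ℤ.+-identityʳ (tileEntry t b (suc zero) 0ℙ)))
          ([1+b+xℓ]⊖[1+b+yℓ] b (offset t zero 0ℙ) (offset t (suc zero) 0ℙ) ℓ)
  tile-colSum t b 1ℙ =
    trans (cong (tileEntry t b zero 1ℙ +ℤ_) (ℤ.+-identityʳ (tileEntry t b (suc zero) 1ℙ)))
          ([1+b+xℓ]⊖[1+b+yℓ] b (offset t (suc zero) 1ℙ) (offset t zero 1ℙ) ℓ)

  tile-row-balanced : ∀ t b r → #pos (tileEntry t b r 0ℙ ∷ tileEntry t b r 1ℙ ∷ [])
                                ≡ #neg (tileEntry t b r 0ℙ ∷ tileEntry t b r 1ℙ ∷ [])
  tile-row-balanced t b zero       = refl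
  tile-row-balanced t b (suc zero) = refl

  tile-col-balanced : ∀ t b c → #pos (λ r → tileEntry t b r c) ≡ #neg (λ r → tileEntry t b r c)
  tile-col-balanced t b 0ℙ = refl
  tile-col-balanced t b 1ℙ = refl

alternating : ℕ → TileType
alternating zero          = plus₁
alternating (suc zero)    = minus₁
alternating (suc (suc i)) = alternating i

oddPattern : ℕ → TileType
oddPattern zero                = plus₂
oddPattern (suc zero)          = minus₁
oddPattern (suc (suc zero))    = minus₁
oddPattern (suc (suc (suc i))) = alternating i

tilePattern : Parity → ℕ → TileType
tilePattern 0ℙ = alternating
tilePattern 1ℙ = oddPattern

module _ (d : TileType → ℤ) (d-minus₁ : d minus₁ ≡ - d plus₁) where

  alternating-cancels : ∀ k → sumℤ {double k} (λ i → d (alternating (toℕ i))) ≡ 0ℤ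
  alternating-cancels zero    = refl
  alternating-cancels (suc k) = begin
    d plus₁ +ℤ (d minus₁ +ℤ sumℤ {double k} (λ i → d (alternating (toℕ i))))
      ≡⟨ cong (λ x → d plus₁ +ℤ (d minus₁ +ℤ x)) (alternating-cancels k) ⟩
    d plus₁ +ℤ (d minus₁ +ℤ 0ℤ)  ≡⟨ cong (d plus₁ +ℤ_) (trans (ℤ.+-identityʳ (d minus₁)) d-minus₁) ⟩
    d plus₁ +ℤ - d plus₁          ≡⟨ ℤ.+-inverseʳ (d plus₁) ⟩
    0ℤ                            ∎
    where open ≡-Reasoning

  oddPattern-cancels : d plus₂ ≡ d plus₁ +ℤ d plus₁ →
                       ∀ k → sumℤ {3 + double k} (λ i → d (oddPattern (toℕ i))) ≡ 0ℤ
  oddPattern-cancels d-plus₂ k = begin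
    d plus₂ +ℤ (d minus₁ +ℤ (d minus₁ +ℤ sumℤ {double k} (λ i → d (alternating (toℕ i)))))
      ≡⟨ cong (λ x → d plus₂ +ℤ (d minus₁ +ℤ (d minus₁ +ℤ x))) (alternating-cancels k) ⟩
    d plus₂ +ℤ (d minus₁ +ℤ (d minus₁ +ℤ 0ℤ))
      ≡⟨ cong₂ (λ x y → x +ℤ (y +ℤ (y +ℤ 0ℤ))) d-plus₂ d-minus₁ ⟩
    (d plus₁ +ℤ d plus₁) +ℤ (- d plus₁ +ℤ (- d plus₁ +ℤ 0ℤ))
      ≡⟨ x+x-x-x≡0 (d plus₁) ⟩
    0ℤ ∎
    where
    open ≡-Reasoning
    x+x-x-x≡0 : ∀ x → (x +ℤ x) +ℤ (- x +ℤ (- x +ℤ 0ℤ)) ≡ 0ℤ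
    x+x-x-x≡0 = ℤ-solve-∀

  tilePattern-cancels : d plus₂ ≡ d plus₁ +ℤ d plus₁ →
                        ∀ w → 3 ≤ w → sumℤ {w} (λ i → d (tilePattern (parity w) (toℕ i))) ≡ 0ℤ
  tilePattern-cancels d-plus₂ w 3≤w =
    subst (λ n → sumℤ {n} (λ i → d (tilePattern (parity w) (toℕ i))) ≡ 0ℤ)
          (column-⌊/2⌋-parity w)
          (cancels ⌊ w /2⌋ (parity w) (subst (3 ≤_) (sym (column-⌊/2⌋-parity w)) 3≤w))
    where
    cancels : ∀ k c → 3 ≤ column k c → sumℤ {column k c} (λ i → d (tilePattern c (toℕ i))) ≡ 0ℤ
    cancels k       0ℙ _ = alternating-cancels k
    cancels (suc k) 1ℙ _ = oddPattern-cancels d-plus₂ k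
    cancels zero    1ℙ (s≤s ())

rowWeight-minus₁ : ∀ r → rowWeight minus₁ r ≡ - rowWeight plus₁ r
rowWeight-minus₁ zero       = refl
rowWeight-minus₁ (suc zero) = refl

rowWeight-plus₂ : ∀ r → rowWeight plus₂ r ≡ rowWeight plus₁ r +ℤ rowWeight plus₁ r
rowWeight-plus₂ zero       = refl
rowWeight-plus₂ (suc zero) = refl

[r+qn]/n≡q : ∀ {r} q {n} .{{_ : NonZero n}} → r < n → (r + q * n) / n ≡ q
[r+qn]/n≡q {r} q {n} r<n = begin
  (r + q * n) / n        ≡⟨ +-distrib-/-∣ʳ r (n∣m*n q) ⟩
  r / n + q * n / n      ≡⟨ cong₂ _+_ (m<n⇒m/n≡0 r<n) (m*n/n≡m q n) ⟩
  q                      ∎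
  where open ≡-Reasoning

[r+qn]%n≡r : ∀ {r} q {n} .{{_ : NonZero n}} → r < n → (r + q * n) % n ≡ r
[r+qn]%n≡r {r} q {n} r<n = trans ([m+kn]%n≡m%n r q n) (m<n⇒m%n≡m r<n)

r+qn<bn : ∀ {r q n b} → r < n → q < b → r + q * n < b * n
r+qn<bn {q = q} {n} r<n q<b = ℕ.≤-trans (ℕ.+-monoˡ-< (q * n) r<n) (ℕ.*-monoˡ-≤ n q<b)

PuncturedRange : ℕ → ℕ → ℕ → Set
PuncturedRange h ℓ x = (1 ≤ x × x ≤ h * ℓ) × ¬ (∃ λ j → 1 ≤ j × j ≤ h × x ≡ j * ℓ)

1+r+qℓ∈PuncturedRange : ∀ {K h q r} → r < K → q < h → PuncturedRange h (suc K) (suc (r + q * suc K))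
1+r+qℓ∈PuncturedRange {K} {h} {q} {r} r<K q<h =
  (s≤s z≤n , r+qn<bn (ℕ.m<n⇒m<1+n r<K) q<h) , not-multiple
  where
  not-multiple : ¬ (∃ λ j → 1 ≤ j × j ≤ h × suc (r + q * suc K) ≡ j * suc K)
  not-multiple (j , _ , _ , eq) = ℕ.0≢1+n (begin
    0                            ≡⟨ m*n%n≡0 j (suc K) ⟨
    j * suc K % suc K            ≡⟨ cong (_% suc K) eq ⟨
    (suc r + q * suc K) % suc K  ≡⟨ [r+qn]%n≡r q (s≤s r<K) ⟩
    suc r                        ∎)
    where open ≡-Reasoning

PuncturedRange⇒1+r+qℓ : ∀ {K h x} → PuncturedRange h (suc K) x →
                        ∃₂ λ q r → q < h × r < K × x ≡ suc (r + q * suc K)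
PuncturedRange⇒1+r+qℓ {x = zero} ((() , _) , _)
PuncturedRange⇒1+r+qℓ {K} {h} {suc y} ((_ , x≤hℓ) , not-multiple) =
  y / ℓ , y % ℓ , q<h , ℕ.≤∧≢⇒< (ℕ.≤-pred (m%n<n y ℓ)) r≢K , cong suc y≡r+qℓ
  where
  ℓ = suc K
  y≡r+qℓ : y ≡ y % ℓ + y / ℓ * ℓ
  y≡r+qℓ = m≡m%n+[m/n]*n y ℓ
  q<h : y / ℓ < h
  q<h = m<n*o⇒m/o<n x≤hℓ
  r≢K : y % ℓ ≢ K
  r≢K r≡K =
    not-multiple (suc (y / ℓ) , s≤s z≤n , q<h , cong suc (trans y≡r+qℓ (cong (_+ y / ℓ * ℓ) r≡K)))

module Construction (w K : ℕ) .{{_ : NonZero w}} .{{_ : NonZero K}} where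

  ℓ : ℕ
  ℓ = suc K

  open Tiles ℓ

  tileType : ℕ → TileType
  tileType = tilePattern (parity w)

  base : ℕ → ℕ
  base f = f % K + f / K * 4 * ℓ

  base+oℓ : ∀ f o → base f + o * ℓ ≡ f % K + (o + f / K * 4) * ℓ
  base+oℓ f o = regroup (f % K) (f / K) o ℓ
    where
    regroup : ∀ r u o ℓ → r + u * 4 * ℓ + o * ℓ ≡ r + (o + u * 4) * ℓ
    regroup = solve-∀

  entry : ℕ → Fin 2 → ℕ → ℤ
  entry q r j = tileEntry (tileType ⌊ j /2⌋) (base (⌊ j /2⌋ + q * w)) r (parity j)

  blocks : (M : ℕ) → Fin M → Block 2 (double w)
  blocks M q r j = entry (toℕ q) r (toℕ j)

  entry-column : ∀ q r i c → entry q r (column i c) ≡ tileEntry (tileType i) (base (i + q * w)) r c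
  entry-column q r i c rewrite ⌊column/2⌋≡i i c | parity-column i c = refl

  row-sum : 3 ≤ w → ∀ q r → sumℤ {double w} (λ j → entry q r (toℕ j)) ≡ 0ℤ
  row-sum 3≤w q r = begin
    sumℤ {double w} (λ j → entry q r (toℕ j))             ≡⟨ sumℤ-pairs w (entry q r) _ tile-sum ⟩
    sumℤ {w} (λ i → weight (toℕ i) *ℤ + ℓ)                ≡⟨ sumℤ-*ʳ {w} (λ i → weight (toℕ i)) (+ ℓ) ⟩
    sumℤ {w} (λ i → weight (toℕ i)) *ℤ + ℓ                ≡⟨ cong (_*ℤ + ℓ) weights-cancel ⟩
    0ℤ                                                     ∎
    where
    open ≡-Reasoning
    weight : ℕ → ℤ
    weight i = rowWeight (tileType i) r
    tile-sum : ∀ i → entry q r (column i 0ℙ) +ℤ entry q r (column i 1ℙ) ≡ weight i *ℤ + ℓ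
    tile-sum i = trans (cong₂ _+ℤ_ (entry-column q r i 0ℙ) (entry-column q r i 1ℙ))
                       (tile-rowSum (tileType i) (base (i + q * w)) r)
    weights-cancel : sumℤ {w} (λ i → weight (toℕ i)) ≡ 0ℤ
    weights-cancel =
      tilePattern-cancels (λ t → rowWeight t r) (rowWeight-minus₁ r) (rowWeight-plus₂ r) w 3≤w

  row-balanced : ∀ q r → #pos {double w} (λ j → entry q r (toℕ j))
                         ≡ #neg {double w} (λ j → entry q r (toℕ j))
  row-balanced q r = #pos≡#neg-pairs w (entry q r) λ i →
    subst₂ (λ x y → #pos (x ∷ y ∷ []) ≡ #neg (x ∷ y ∷ []))
           (sym (entry-column q r i 0ℙ)) (sym (entry-column q r i 1ℙ))
           (tile-row-balanced (tileType i) (base (i + q * w)) r)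

  column-sum : ∀ q i c → sumℤ (λ r → entry q r (column i c)) ≡ colWeight (tileType i) c *ℤ + ℓ
  column-sum q i c rewrite ⌊column/2⌋≡i i c | parity-column i c =
    tile-colSum (tileType i) (base (i + q * w)) c

  σ : ℕ → ℤ
  σ i = colWeight (tileType i) 0ℙ *ℤ + ℓ

  blocks-conditionC : ∀ M → 3 ≤ w → ConditionC (blocks M)
  blocks-conditionC M 3≤w = σ , λ q →
      (row-balanced (toℕ q) ,
       λ j → tile-col-balanced (tileType ⌊ toℕ j /2⌋) (base (⌊ toℕ j /2⌋ + toℕ q * w)) (parity (toℕ j)))
    , row-sum 3≤w (toℕ q)
    , (λ i j j≡2i → subst (λ j → sumℤ (λ r → entry (toℕ q) r j) ≡ σ i)
                          (sym (trans j≡2i (sym (double≡2* i)))) (column-sum (toℕ q) i 0ℙ))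
    , (λ i j j≡2i+1 → subst (λ j → sumℤ (λ r → entry (toℕ q) r j) ≡ - σ i)
                            (sym (trans j≡2i+1 (2i+1≡column i))) (odd-column-sum (toℕ q) i))
    where
    2i+1≡column : ∀ i → 2 * i + 1 ≡ column i 1ℙ
    2i+1≡column i = trans (ℕ.+-comm (2 * i) 1) (cong suc (sym (double≡2* i)))
    odd-column-sum : ∀ q i → sumℤ (λ r → entry q r (column i 1ℙ)) ≡ - σ i
    odd-column-sum q i = trans (column-sum q i 1ℙ)
      (trans (cong (_*ℤ + ℓ) (colWeight-1ℙ (tileType i)))
             (sym (ℤ.neg-distribˡ-* (colWeight (tileType i) 0ℙ) (+ ℓ))))

  label : ℕ → ℕ → ℕ
  label f o = suc (f % K + (o + f / K * 4) * ℓ)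

  ∣tileEntry∣≡label : ∀ t f r c → ∣ tileEntry t (base f) r c ∣ ≡ label f (offset t r c)
  ∣tileEntry∣≡label t f r c = trans (∣tileEntry∣ t (base f) r c) (cong suc (base+oℓ f (offset t r c)))

  label∈PuncturedRange : ∀ {g f o} → f < g * K → o < 4 → PuncturedRange (g * 4) ℓ (label f o)
  label∈PuncturedRange {g} f<gK o<4 =
    1+r+qℓ∈PuncturedRange (m%n<n _ K) (r+qn<bn o<4 (m<n*o⇒m/o<n {n = g} f<gK))

  1+r+qℓ≡label : ∀ {ρ} Q → ρ < K → suc (ρ + Q * ℓ) ≡ label (ρ + Q / 4 * K) (Q % 4)
  1+r+qℓ≡label {ρ} Q ρ<K = begin
    suc (ρ + Q * ℓ)                    ≡⟨ cong (λ a → suc (ρ + a * ℓ)) (m≡m%n+[m/n]*n Q 4) ⟩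
    suc (ρ + (Q % 4 + Q / 4 * 4) * ℓ)  ≡⟨ cong₂ (λ a b → suc (a + (Q % 4 + b * 4) * ℓ))
                                               ([r+qn]%n≡r (Q / 4) ρ<K) ([r+qn]/n≡q (Q / 4) ρ<K) ⟨
    label (ρ + Q / 4 * K) (Q % 4)      ∎
    where open ≡-Reasoning

  module _ {M g : ℕ} (Mw≡gK : M * w ≡ g * K) where

    supp⇒PuncturedRange : ∀ x → InSupp (blocks M) x → PuncturedRange (g * 4) ℓ x
    supp⇒PuncturedRange x (q , r , j , ∣entry∣≡x) =
      subst (PuncturedRange (g * 4) ℓ) ∣entry∣≡label-f-o (label∈PuncturedRange {g} f<gK (offset<4 t r c))
      where
      i = ⌊ toℕ j /2⌋
      f = i + toℕ q * w
      t = tileType i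
      c = parity (toℕ j)
      f<gK : f < g * K
      f<gK = subst (f <_) Mw≡gK (r+qn<bn (⌊j/2⌋<w (toℕ<n j)) (toℕ<n q))
      ∣entry∣≡label-f-o : label f (offset t r c) ≡ x
      ∣entry∣≡label-f-o = trans (sym (∣tileEntry∣≡label t f r c)) ∣entry∣≡x

    label∈supp : ∀ {f o} → f < g * K → o < 4 → InSupp (blocks M) (label f o)
    label∈supp {f} {o} f<gK o<4 with offset-surjective (tileType (f % w)) o o<4
    ... | r , c , offset≡o = fromℕ< q<M , r , fromℕ< j<2w , ∣entry∣≡label
      where
      q = f / w
      i = f % w
      q<M : q < M
      q<M = m<n*o⇒m/o<n (subst (f <_) (sym Mw≡gK) f<gK)
      j<2w : column i c < double w
      j<2w = column<double c (m%n<n f w)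
      ∣entry∣≡label : ∣ blocks M (fromℕ< q<M) r (fromℕ< j<2w) ∣ ≡ label f o
      ∣entry∣≡label = begin
        ∣ entry (toℕ (fromℕ< q<M)) r (toℕ (fromℕ< j<2w)) ∣
          ≡⟨ cong₂ (λ a b → ∣ entry a r b ∣) (toℕ-fromℕ< q<M) (toℕ-fromℕ< j<2w) ⟩
        ∣ entry q r (column i c) ∣                  ≡⟨ cong ∣_∣ (entry-column q r i c) ⟩
        ∣ tileEntry (tileType i) (base (i + q * w)) r c ∣
          ≡⟨ ∣tileEntry∣≡label (tileType i) (i + q * w) r c ⟩
        label (i + q * w) (offset (tileType i) r c) ≡⟨ cong₂ label (sym (m≡m%n+[m/n]*n f w)) offset≡o ⟩
        label f o                                   ∎
        where open ≡-Reasoning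

    PuncturedRange⇒supp : ∀ x → PuncturedRange (g * 4) ℓ x → InSupp (blocks M) x
    PuncturedRange⇒supp x x∈ with PuncturedRange⇒1+r+qℓ x∈
    ... | Q , ρ , Q<g4 , ρ<K , refl =
      subst (InSupp (blocks M)) (sym (1+r+qℓ≡label Q ρ<K))
            (label∈supp (r+qn<bn ρ<K (m<n*o⇒m/o<n {n = g} Q<g4)) (m%n<n Q 4))

    supp⇔PuncturedRange : ∀ x → InSupp (blocks M) x ⇔ PuncturedRange (g * 4) ℓ x
    supp⇔PuncturedRange x = mk⇔ (supp⇒PuncturedRange x) (PuncturedRange⇒supp x)

BlockSequence : (M s bound h ℓ : ℕ) → Set
BlockSequence M s bound h ℓ =
  Σ (Fin M → Block 2 s) λ ℬ → ConditionC ℬ ×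
    ((x : ℕ) → InSupp ℬ x ⇔ ((1 ≤ x × x ≤ bound) × ¬ (∃ λ j → 1 ≤ j × j ≤ h × x ≡ j * ℓ)))

BlockSequence-cong : ∀ {M s s′ b b′ h h′ ℓ ℓ′} → s ≡ s′ → b ≡ b′ → h ≡ h′ → ℓ ≡ ℓ′ →
                     BlockSequence M s b h ℓ → BlockSequence M s′ b′ h′ ℓ′
BlockSequence-cong refl refl refl refl ℬ = ℬ

blockSequence : ∀ {M w K g} .{{_ : NonZero K}} → 3 ≤ w → M * w ≡ g * K →
                BlockSequence M (double w) (g * 4 * suc K) (g * 4) (suc K)
blockSequence {M} {w} {K} {g} 3≤w Mw≡gK =
  blocks M , blocks-conditionC M 3≤w , supp⇔PuncturedRange {M} {g} Mw≡gK
  where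
  instance
    w≢0 : NonZero w
    w≢0 = >-nonZero (ℕ.≤-trans (s≤s z≤n) 3≤w)
  open Construction w K

double[n/2]≡n : ∀ {n} → 2 ∣ n → double (n / 2) ≡ n
double[n/2]≡n {n} 2∣n = trans (double≡2* (n / 2)) (m*[n/m]≡n 2∣n)

[t/8]*4≡t/2 : ∀ {t} → 8 ∣ t → t / 8 * 4 ≡ t / 2
[t/8]*4≡t/2 {t} 8∣t = begin
  t / 8 * 4          ≡⟨ m*n/n≡m (t / 8 * 4) 2 ⟨
  t / 8 * 4 * 2 / 2  ≡⟨ /-congˡ (trans (ℕ.*-assoc (t / 8) 4 2) (m/n*n≡m 8∣t)) ⟩
  t / 2              ∎
  where open ≡-Reasoning

m*s≡[t/8]*K*4 : ∀ {m s t K} → 8 ∣ t → K * t ≡ 2 * m * s → m * s ≡ t / 8 * K * 4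
m*s≡[t/8]*K*4 {m} {s} {t} {K} 8∣t Kt≡2ms = ℕ.*-cancelˡ-≡ (m * s) (t / 8 * K * 4) 2 (begin
  2 * (m * s)          ≡⟨ ℕ.*-assoc 2 m s ⟨
  2 * m * s            ≡⟨ Kt≡2ms ⟨
  K * t                ≡⟨ cong (K *_) (m/n*n≡m 8∣t) ⟨
  K * (t / 8 * 8)      ≡⟨ regroup K (t / 8) ⟩
  2 * (t / 8 * K * 4)  ∎)
  where
  open ≡-Reasoning
  regroup : ∀ K g → K * (g * 8) ≡ 2 * (g * K * 4)
  regroup = solve-∀

[m/2]*[s/2]≡[t/8]*K : ∀ {m s t K} → 2 ∣ m → 2 ∣ s → 8 ∣ t → K * t ≡ 2 * m * s →
                      m / 2 * (s / 2) ≡ t / 8 * K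
[m/2]*[s/2]≡[t/8]*K {m} {s} {t} {K} 2∣m 2∣s 8∣t Kt≡2ms = ℕ.*-cancelʳ-≡ _ _ 4 (begin
  m / 2 * (s / 2) * 4          ≡⟨ regroup (m / 2) (s / 2) ⟩
  m / 2 * 2 * (s / 2 * 2)      ≡⟨ cong₂ _*_ (m/n*n≡m 2∣m) (m/n*n≡m 2∣s) ⟩
  m * s                        ≡⟨ m*s≡[t/8]*K*4 {m} {s} 8∣t Kt≡2ms ⟩
  t / 8 * K * 4                ∎)
  where
  open ≡-Reasoning
  regroup : ∀ M w → M * w * 4 ≡ M * 2 * (w * 2)
  regroup = solve-∀

[t/8]*4*[1+K]≡m*s+t/2 : ∀ {m s t K} → 8 ∣ t → K * t ≡ 2 * m * s → t / 8 * 4 * suc K ≡ m * s + t / 2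
[t/8]*4*[1+K]≡m*s+t/2 {m} {s} {t} {K} 8∣t Kt≡2ms = begin
  t / 8 * 4 * suc K            ≡⟨ regroup (t / 8) K ⟩
  t / 8 * K * 4 + t / 8 * 4    ≡⟨ cong₂ _+_ (sym (m*s≡[t/8]*K*4 {m} {s} 8∣t Kt≡2ms)) ([t/8]*4≡t/2 8∣t) ⟩
  m * s + t / 2                ∎
  where
  open ≡-Reasoning
  regroup : ∀ g K → g * 4 * suc K ≡ g * K * 4 + g * 4
  regroup = solve-∀

lemma4p3 : (m s p t : ℕ) → .{{_ : NonZero p}} → .{{_ : NonZero t}} →
           2 ∣ m → 2 ∣ s → 2 ≤ m → 6 ≤ s →
           Prime p → ¬ (2 ∣ p) → p ∣ s →
           t ∣ (2 * m * s) / p → 8 ∣ t →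
           Σ (Fin (m / 2) → Block 2 s) λ ℬ →
             ConditionC ℬ ×
             ((x : ℕ) → InSupp ℬ x ⇔
               ((1 ≤ x × x ≤ m * s + t / 2) ×
                ¬ (∃ λ j → 1 ≤ j × j ≤ t / 2 × x ≡ j * ((2 * m * s) / t + 1))))
lemma4p3 m s p t 2∣m 2∣s m≥2 s≥6 _ _ p∣s t∣N/p 8∣t =
  BlockSequence-cong (double[n/2]≡n 2∣s) ([t/8]*4*[1+K]≡m*s+t/2 {m} {s} 8∣t Kt≡N)
                     ([t/8]*4≡t/2 8∣t) (ℕ.+-comm 1 K)
    (blockSequence {m / 2} {s / 2} {K} {t / 8} (/-monoˡ-≤ 2 s≥6) ([m/2]*[s/2]≡[t/8]*K 2∣m 2∣s 8∣t Kt≡N))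
  where
  N = 2 * m * s
  K = N / t
  t∣N : t ∣ N
  t∣N = m*n∣⇒m∣ t p (m∣n/o⇒m*o∣n (∣n⇒∣m*n (2 * m) p∣s) t∣N/p)
  Kt≡N : K * t ≡ N
  Kt≡N = m/n*n≡m t∣N
  instance
    N≢0 : NonZero N
    N≢0 = >-nonZero (ℕ.≤-trans (s≤s z≤n) (ℕ.*-mono-≤ (ℕ.*-monoʳ-≤ 2 m≥2) s≥6))
    K≢0 : NonZero K
    K≢0 = >-nonZero (m≥n⇒m/n>0 (∣⇒≤ t∣N))
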